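{- For every $g\in\{0\}\cup\mathbb N$, the set $\{p\in\mathcal P^{\circ\bullet}\mid \sigma_p(B)\in g\mathbb Z\text{ for every block }B\text{ of }p\}$ is a category of two-colored partitions.
   Context: A two-colored partition $p$ consists of a lower row $R_L$ and an upper row $R_U$ (disjoint, possibly empty, finite totally ordered sets), a decomposition of $P_p=R_L\cup R_U$ into disjoint nonempty blocks, and a coloring of each point by $\circ$ or $\bullet$; $\mathcal P^{\circ\bullet}$ is the set of all such. The normalized color of a lower point is its color, that of an upper point is its inverse color; $\sigma_p(S)$ is the number of normalized-white minus the number of normalized-black points in $S$. Category: A set $\mathcal C\subseteq\mathcal P^{\circ\bullet}$ is a category if it contains the empty partition, the two partitions with one lower and one upper point of the same color ($\circ$ or $\bullet$) forming one block, and the two partitions without upper points having two lower points colored $\bullet\circ$ resp. $\circ\bullet$ forming one block, and is closed under: tensor product (append the rows of the second partition to the right of those of the first); involution (exchange upper and lower rows); and composition $pp'$ of pairs $(p,p')$ where the upper row of $p$ and lower row of $p'$ have equal length and equal colors rank by rank, defined by taking the lower row of $p$ and the upper row of $p'$ as rows, identifying the upper row of $p$ with the lower row of $p'$, and letting the blocks be the nonempty intersections with the new point set of the classes of the equivalence relation generated by the blocks of $p$ and of $p'$. -}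

module Defs where

open import Data.Nat using (ℕ; zero; suc; _+_; _≡ᵇ_)
open import Data.Fin using (Fin; zero; suc; _↑ˡ_; _↑ʳ_)
open import Data.Sum using (_⊎_; inj₁; inj₂)
open import Data.Bool using (if_then_else_)
open import Data.Integer as ℤ using (ℤ; +_; 0ℤ; 1ℤ; -1ℤ)
open import Data.Integer.Divisibility using (_∣_)
open import Data.Product using (_×_)
open import Data.Unit using (⊤)
open import Function.Bundles using (_⇔_)
open import Relation.Binary.PropositionalEquality using (_≡_)
open import Relation.Nullary using (¬_)

data Color : Set where
  white black : Color   -- white = ∘ , black = •

inv : Color → Color
inv white = black
inv black = white

-- Points of a partition with k lower and l upper points:
-- inj₁ i = i-th lower point, inj₂ j = j-th upper point (rows ordered by Fin).
Pt : ℕ → ℕ → Set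
Pt k l = Fin k ⊎ Fin l

-- A two-colored partition: a coloring of the points and a block labelling;
-- the blocks are the (nonempty) fibres of blk, i.e. x, y lie in the same
-- block iff blk x ≡ blk y.
record Partition (k l : ℕ) : Set where
  field
    col : Pt k l → Color
    blk : Pt k l → ℕ
open Partition public

SameBlock : ∀ {k l} → Partition k l → Pt k l → Pt k l → Set
SameBlock p x y = blk p x ≡ blk p y

normCol : ∀ {k l} → Partition k l → Pt k l → Color
normCol p (inj₁ i) = col p (inj₁ i)
normCol p (inj₂ j) = inv (col p (inj₂ j))

sign : Color → ℤ
sign white = 1ℤ
sign black = -1ℤ

sumFin : ∀ n → (Fin n → ℤ) → ℤ
sumFin zero    f = 0ℤ
sumFin (suc n) f = f zero ℤ.+ sumFin n (λ i → f (suc i))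

contrib : ∀ {k l} → Partition k l → ℕ → Pt k l → ℤ
contrib p b x = if blk p x ≡ᵇ b then sign (normCol p x) else 0ℤ

σ : ∀ {k l} → Partition k l → ℕ → ℤ
σ {k} {l} p b = sumFin k (λ i → contrib p b (inj₁ i)) ℤ.+ sumFin l (λ j → contrib p b (inj₂ j))

IsEmptyPartition : Partition 0 0 → Set
IsEmptyPartition p = ⊤

IsIdPartition : Color → Partition 1 1 → Set
IsIdPartition c p = (col p (inj₁ zero) ≡ c) × (col p (inj₂ zero) ≡ c)
                  × SameBlock p (inj₁ zero) (inj₂ zero)

IsPairPartition : Color → Color → Partition 2 0 → Set
IsPairPartition c₁ c₂ p = (col p (inj₁ zero) ≡ c₁) × (col p (inj₁ (suc zero)) ≡ c₂)
                        × SameBlock p (inj₁ zero) (inj₁ (suc zero))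

emb₁ : ∀ {k l} k' l' → Pt k l → Pt (k + k') (l + l')
emb₁ k' l' (inj₁ i) = inj₁ (i ↑ˡ k')
emb₁ k' l' (inj₂ j) = inj₂ (j ↑ˡ l')

emb₂ : ∀ k l {k' l'} → Pt k' l' → Pt (k + k') (l + l')
emb₂ k l (inj₁ i) = inj₁ (k ↑ʳ i)
emb₂ k l (inj₂ j) = inj₂ (l ↑ʳ j)

record IsTensor {k l k' l'} (p : Partition k l) (p' : Partition k' l')
                (q : Partition (k + k') (l + l')) : Set where
  field
    col₁  : ∀ x → col q (emb₁ k' l' x) ≡ col p x
    col₂  : ∀ y → col q (emb₂ k l y) ≡ col p' y
    blk₁  : ∀ x x' → SameBlock q (emb₁ k' l' x) (emb₁ k' l' x') ⇔ SameBlock p x x'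
    blk₂  : ∀ y y' → SameBlock q (emb₂ k l y) (emb₂ k l y') ⇔ SameBlock p' y y'
    blk₁₂ : ∀ x y → ¬ SameBlock q (emb₁ k' l' x) (emb₂ k l y)

swapPt : ∀ {k l} → Pt l k → Pt k l
swapPt (inj₁ j) = inj₂ j
swapPt (inj₂ i) = inj₁ i

record IsInvolution {k l} (p : Partition k l) (q : Partition l k) : Set where
  field
    colI : ∀ x → col q x ≡ col p (swapPt x)
    blkI : ∀ x y → SameBlock q x y ⇔ SameBlock p (swapPt x) (swapPt y)

-- Composition p p' : p has k lower / l upper points, p' has l lower / m upper.
-- Joint point set: lower row of p, identified middle row, upper row of p'.
data Pt3 (k l m : ℕ) : Set where
  low : Fin k → Pt3 k l m
  mid : Fin l → Pt3 k l m
  up  : Fin m → Pt3 k l m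

ιp : ∀ {k l m} → Pt k l → Pt3 k l m
ιp (inj₁ i) = low i
ιp (inj₂ j) = mid j

ιp' : ∀ {k l m} → Pt l m → Pt3 k l m
ιp' (inj₁ j) = mid j
ιp' (inj₂ u) = up u

ιq : ∀ {k l m} → Pt k m → Pt3 k l m
ιq (inj₁ i) = low i
ιq (inj₂ u) = up u

data Gen {k l m} (p : Partition k l) (p' : Partition l m) : Pt3 k l m → Pt3 k l m → Set where
  viaP   : ∀ {x y} → SameBlock p x y  → Gen p p' (ιp x) (ιp y)
  viaP'  : ∀ {x y} → SameBlock p' x y → Gen p p' (ιp' x) (ιp' y)
  grefl  : ∀ {a} → Gen p p' a a
  gsym   : ∀ {a b} → Gen p p' a b → Gen p p' b a
  gtrans : ∀ {a b c} → Gen p p' a b → Gen p p' b c → Gen p p' a c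

Composable : ∀ {k l m} → Partition k l → Partition l m → Set
Composable p p' = ∀ j → col p (inj₂ j) ≡ col p' (inj₁ j)

record IsComposition {k l m} (p : Partition k l) (p' : Partition l m)
                     (q : Partition k m) : Set where
  field
    colL : ∀ i → col q (inj₁ i) ≡ col p (inj₁ i)
    colU : ∀ u → col q (inj₂ u) ≡ col p' (inj₂ u)
    blkC : ∀ x y → SameBlock q x y ⇔ Gen p p' (ιq x) (ιq y)

-- Categories of two-colored partitions.  A set of partitions is given as a
-- predicate on representations; membership of a partition means membership
-- of (every) representation of it.
PSet : Set₁
PSet = ∀ {k l} → Partition k l → Set

record IsCategory (C : PSet) : Set where
  field
    hasEmpty : ∀ p → IsEmptyPartition p → C p
    hasIdW   : ∀ p → IsIdPartition white p → C p
    hasIdB   : ∀ p → IsIdPartition black p → C p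
    hasPairBW : ∀ p → IsPairPartition black white p → C p
    hasPairWB : ∀ p → IsPairPartition white black p → C p
    tensor  : ∀ {k l k' l'} (p : Partition k l) (p' : Partition k' l') q →
              C p → C p' → IsTensor p p' q → C q
    involution : ∀ {k l} (p : Partition k l) q → C p → IsInvolution p q → C q
    composition : ∀ {k l m} (p : Partition k l) (p' : Partition l m) q →
              C p → C p' → Composable p p' → IsComposition p p' q → C q

-- The set of the lemma: σ_p(B) ∈ gℤ for every block B of p
-- (every block is the block blk p x of some point x).
Cg : ℕ → PSet
Cg g p = ∀ x → (+ g) ∣ σ p (blk p x)

-- A block's σ is a signed count of its points, so it is additive under disjoint unions.
-- Tensoring and involution leave every block intact (involution only negates σ), and the
-- unit partitions have σ = 0 on their single block.  A block of a composite pq is what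
-- remains of a union of blocks of p and of blocks of p' after deleting the middle row; each
-- middle point contributes +1 on one side and −1 on the other, so σ of the new block is the
-- sum of σ over those old blocks, hence again a multiple of g.  Deciding which points lie in
-- that union is not constructive, but divisibility is decidable, so it suffices to argue
-- under a double negation.
module Submission where

open import Defs
open import Data.Nat as ℕ using (ℕ; zero; suc; _≡ᵇ_; _<_; _⊔_)
import Data.Nat.Properties as ℕ
open import Data.Fin using (Fin; zero; suc; _↑ˡ_; _↑ʳ_; splitAt)
open import Data.Fin.Properties using (splitAt⁻¹-↑ˡ; splitAt⁻¹-↑ʳ)
open import Data.Sum using (_⊎_; inj₁; inj₂)
open import Data.Bool using (Bool; true; false; _∧_; not; if_then_else_)
open import Data.Bool.Properties using (∧-zeroʳ)
open import Data.Integer as ℤ using (ℤ; +_; _+_; -_; 0ℤ)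
import Data.Integer.Properties as ℤ
open import Data.Integer.Divisibility.Signed
  using (_∣_; divides; _∣?_; ∣m∣n⇒∣m+n; ∣m⇒∣-m; ∣ᵤ⇒∣; ∣⇒∣ᵤ)
open import Algebra.Properties.CommutativeSemigroup ℤ.+-commutativeSemigroup using (interchange)
open import Data.Product using (_×_; _,_; ∃)
open import Function using (_∘_)
open import Function.Bundles using (_⇔_; mk⇔; Equivalence)
open import Effect.Monad using (RawMonad)
open import Level using (0ℓ)
open import Relation.Binary.PropositionalEquality
open import Relation.Nullary using (¬_; Dec; yes; no; does)
open import Relation.Nullary.Decidable using (decidable-stable; dec-true; dec-false; does-⇔; ¬¬-excluded-middle)
open import Relation.Nullary.Negation using (¬¬-Monad; contradiction)

∣0 : ∀ {g} → g ∣ 0ℤ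
∣0 = divides 0ℤ refl

∣-stable : ∀ {g a} → ¬ ¬ (g ∣ a) → g ∣ a
∣-stable {g} {a} = decidable-stable (g ∣? a)

-- Sums over the points of a partition

sumFin-cong : ∀ n {f f' : Fin n → ℤ} → (∀ i → f i ≡ f' i) → sumFin n f ≡ sumFin n f'
sumFin-cong zero    f≗f' = refl
sumFin-cong (suc n) f≗f' = cong₂ _+_ (f≗f' zero) (sumFin-cong n (f≗f' ∘ suc))

sumFin-0 : ∀ n → sumFin n (λ _ → 0ℤ) ≡ 0ℤ
sumFin-0 zero    = refl
sumFin-0 (suc n) = trans (ℤ.+-identityˡ _) (sumFin-0 n)

sumFin-+ : ∀ n (f f' : Fin n → ℤ) → sumFin n (λ i → f i + f' i) ≡ sumFin n f + sumFin n f'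
sumFin-+ zero    f f' = refl
sumFin-+ (suc n) f f' = trans (cong (_+_ (f zero + f' zero)) (sumFin-+ n (f ∘ suc) (f' ∘ suc)))
                              (interchange (f zero) (f' zero) _ _)

sumFin-↑ : ∀ m n (f : Fin (m ℕ.+ n) → ℤ) →
           sumFin (m ℕ.+ n) f ≡ sumFin m (λ i → f (i ↑ˡ n)) + sumFin n (λ j → f (m ↑ʳ j))
sumFin-↑ zero    n f = sym (ℤ.+-identityˡ _)
sumFin-↑ (suc m) n f = trans (cong (_+_ (f zero)) (sumFin-↑ m n (f ∘ suc)))
                             (sym (ℤ.+-assoc (f zero) _ _))

sumFin-neg : ∀ n (f : Fin n → ℤ) → sumFin n (λ i → - f i) ≡ - sumFin n f
sumFin-neg zero    f = refl
sumFin-neg (suc n) f = trans (cong (_+_ (- f zero)) (sumFin-neg n (f ∘ suc)))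
                             (sym (ℤ.neg-distrib-+ (f zero) _))

ΣP : ∀ {k l} → (Pt k l → ℤ) → ℤ
ΣP {k} {l} f = sumFin k (f ∘ inj₁) + sumFin l (f ∘ inj₂)

ΣP-cong : ∀ {k l} {f f' : Pt k l → ℤ} → (∀ x → f x ≡ f' x) → ΣP f ≡ ΣP f'
ΣP-cong {k} {l} f≗f' = cong₂ _+_ (sumFin-cong k (f≗f' ∘ inj₁)) (sumFin-cong l (f≗f' ∘ inj₂))

ΣP-0 : ∀ {k l} → ΣP {k} {l} (λ _ → 0ℤ) ≡ 0ℤ
ΣP-0 {k} {l} = cong₂ _+_ (sumFin-0 k) (sumFin-0 l)

ΣP-+ : ∀ {k l} (f f' : Pt k l → ℤ) → ΣP (λ x → f x + f' x) ≡ ΣP f + ΣP f'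
ΣP-+ {k} {l} f f' =
  trans (cong₂ _+_ (sumFin-+ k (f ∘ inj₁) (f' ∘ inj₁)) (sumFin-+ l (f ∘ inj₂) (f' ∘ inj₂)))
        (interchange (sumFin k (f ∘ inj₁)) (sumFin k (f' ∘ inj₁)) (sumFin l (f ∘ inj₂)) (sumFin l (f' ∘ inj₂)))

ΣP-neg : ∀ {k l} (f : Pt k l → ℤ) → ΣP (λ x → - f x) ≡ - ΣP f
ΣP-neg {k} {l} f = trans (cong₂ _+_ (sumFin-neg k (f ∘ inj₁)) (sumFin-neg l (f ∘ inj₂)))
                         (sym (ℤ.neg-distrib-+ (sumFin k (f ∘ inj₁)) (sumFin l (f ∘ inj₂))))

ΣP-swap : ∀ {k l} (f : Pt k l → ℤ) → ΣP (f ∘ swapPt) ≡ ΣP f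
ΣP-swap {k} {l} f = ℤ.+-comm (sumFin l (f ∘ inj₂)) (sumFin k (f ∘ inj₁))

ΣP-⊗ : ∀ {k l k' l'} (f : Pt (k ℕ.+ k') (l ℕ.+ l') → ℤ) →
       ΣP f ≡ ΣP (f ∘ emb₁ k' l') + ΣP (f ∘ emb₂ k l)
ΣP-⊗ {k} {l} {k'} {l'} f =
  trans (cong₂ _+_ (sumFin-↑ k k' (f ∘ inj₁)) (sumFin-↑ l l' (f ∘ inj₂)))
        (interchange (sumFin k (f ∘ inj₁ ∘ (_↑ˡ k'))) (sumFin k' (f ∘ inj₁ ∘ (k ↑ʳ_)))
                     (sumFin l (f ∘ inj₂ ∘ (_↑ˡ l'))) (sumFin l' (f ∘ inj₂ ∘ (l ↑ʳ_))))

ΣP-glue : ∀ {k l m} (F : Pt k l → ℤ) (F' : Pt l m → ℤ) (G : Pt k m → ℤ) →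
          (∀ i → G (inj₁ i) ≡ F (inj₁ i)) → (∀ u → G (inj₂ u) ≡ F' (inj₂ u)) →
          (∀ j → F (inj₂ j) + F' (inj₁ j) ≡ 0ℤ) → ΣP F + ΣP F' ≡ ΣP G
ΣP-glue {k} {l} {m} F F' G lower upper middle = begin
  (A + M) + (M' + U)  ≡⟨ ℤ.+-assoc A M (M' + U) ⟩
  A + (M + (M' + U))  ≡⟨ cong (_+_ A) (ℤ.+-assoc M M' U) ⟨
  A + ((M + M') + U)  ≡⟨ cong (λ z → A + (z + U)) middle-cancels ⟩
  A + (0ℤ + U)        ≡⟨ cong (_+_ A) (ℤ.+-identityˡ U) ⟩
  A + U               ≡⟨ cong₂ _+_ (sumFin-cong k (sym ∘ lower)) (sumFin-cong m (sym ∘ upper)) ⟩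
  ΣP G                ∎
  where
  open ≡-Reasoning
  A  = sumFin k (F ∘ inj₁)
  M  = sumFin l (F ∘ inj₂)
  M' = sumFin l (F' ∘ inj₁)
  U  = sumFin m (F' ∘ inj₂)
  middle-cancels : M + M' ≡ 0ℤ
  middle-cancels = trans (sym (sumFin-+ l (F ∘ inj₂) (F' ∘ inj₁)))
                         (trans (sumFin-cong l middle) (sumFin-0 l))

-- Sums over unions of blocks

onlyIf : Bool → ℤ → ℤ
onlyIf b v = if b then v else 0ℤ

onlyIf-split : ∀ a b v → onlyIf a v ≡ onlyIf (a ∧ b) v + onlyIf (a ∧ not b) v
onlyIf-split true  true  v = sym (ℤ.+-identityʳ v)
onlyIf-split true  false v = sym (ℤ.+-identityˡ v)
onlyIf-split false b     v = refl

≡⇒≡ᵇ-true : ∀ {m n} → m ≡ n → (m ≡ᵇ n) ≡ true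
≡⇒≡ᵇ-true {m} {n} = dec-true (m ℕ.≟ n)

≢⇒≡ᵇ-false : ∀ {m n} → ¬ m ≡ n → (m ≡ᵇ n) ≡ false
≢⇒≡ᵇ-false {m} {n} = dec-false (m ℕ.≟ n)

≡ᵇ-cong-⇔ : ∀ {m n m' n'} → (m ≡ n ⇔ m' ≡ n') → (m ≡ᵇ n) ≡ (m' ≡ᵇ n')
≡ᵇ-cong-⇔ {m} {n} {m'} {n'} iff = does-⇔ iff (m ℕ.≟ n) (m' ℕ.≟ n')

finite-bounded : ∀ n (f : Fin n → ℕ) → ∃ λ N → ∀ i → f i < N
finite-bounded zero    f = 0 , λ ()
finite-bounded (suc n) f with finite-bounded n (f ∘ suc)
... | N , f<N = suc (f zero) ⊔ N , λ where
  zero    → ℕ.m≤m⊔n (suc (f zero)) N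
  (suc i) → ℕ.m<n⇒m<o⊔n (suc (f zero)) (f<N i)

Pt-bounded : ∀ {k l} (f : Pt k l → ℕ) → ∃ λ N → ∀ x → f x < N
Pt-bounded {k} {l} f with finite-bounded k (f ∘ inj₁) | finite-bounded l (f ∘ inj₂)
... | N₁ , lower | N₂ , upper = N₁ ⊔ N₂ , λ where
  (inj₁ i) → ℕ.m<n⇒m<n⊔o N₂ (lower i)
  (inj₂ j) → ℕ.m<n⇒m<o⊔n N₁ (upper j)

module _ {k l} (bl : Pt k l → ℕ) (s : Pt k l → ℤ) where

  sumOn : (Pt k l → Bool) → ℤ
  sumOn h = ΣP λ y → onlyIf (h y) (s y)

  blockSum : ℕ → ℤ
  blockSum b = sumOn λ y → bl y ≡ᵇ b

  RespectsBlocks : (Pt k l → Bool) → Set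
  RespectsBlocks h = ∀ {x y} → bl x ≡ bl y → h x ≡ h y

  private
    block-inside : ∀ (h : Pt k l → Bool) → RespectsBlocks h → ∀ a → h a ≡ true → ∀ y →
                   onlyIf (bl y ≡ᵇ bl a) (s y) ≡ onlyIf (h y ∧ (bl y ≡ᵇ bl a)) (s y)
    block-inside h resp a ha y with bl y ℕ.≟ bl a
    ... | yes e rewrite ≡⇒≡ᵇ-true e | trans (resp e) ha = refl
    ... | no ¬e rewrite ≢⇒≡ᵇ-false ¬e | ∧-zeroʳ (h y) = refl

    block-outside : ∀ (h : Pt k l → Bool) b → ¬ (∃ λ a → h a ≡ true × bl a ≡ b) → ∀ y →
                    onlyIf (h y ∧ (bl y ≡ᵇ b)) (s y) ≡ 0ℤ
    block-outside h b disjoint y with bl y ℕ.≟ b | h y in hy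
    ... | _     | false = refl
    ... | yes e | true  = contradiction (y , hy , e) disjoint
    ... | no ¬e | true rewrite ≢⇒≡ᵇ-false ¬e = refl

  module _ {g} (∣blockSum : ∀ x → g ∣ blockSum (bl x)) where

    private
      sumOn-empty : ∀ {h} → (∀ y → onlyIf (h y) (s y) ≡ 0ℤ) → g ∣ sumOn h
      sumOn-empty empty = subst (g ∣_) (sym (trans (ΣP-cong empty) (ΣP-0 {k} {l}))) ∣0

      -- Whether the block b meets h is undecided, but the goal is stable.
      ∣-block-in-union : ∀ (h : Pt k l → Bool) → RespectsBlocks h → ∀ b →
                         g ∣ sumOn (λ y → h y ∧ (bl y ≡ᵇ b))
      ∣-block-in-union h resp b =
        ∣-stable λ ∤ → ¬¬-excluded-middle {A = ∃ λ a → h a ≡ true × bl a ≡ b} λ where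
          (yes (a , ha , refl)) → ∤ (subst (g ∣_) (ΣP-cong (block-inside h resp a ha)) (∣blockSum a))
          (no  disjoint)        → ∤ (sumOn-empty (block-outside h b disjoint))

      ∣-union-below : ∀ N (h : Pt k l → Bool) → RespectsBlocks h →
                      (∀ y → h y ≡ true → bl y < N) → g ∣ sumOn h
      ∣-union-below zero h resp below = sumOn-empty empty
        where
        empty : ∀ y → onlyIf (h y) (s y) ≡ 0ℤ
        empty y with h y in hy
        ... | false = refl
        ... | true  = contradiction (below y hy) ℕ.n≮0
      ∣-union-below (suc N) h resp below =
        subst (g ∣_) (sym split)
              (∣m∣n⇒∣m+n (∣-block-in-union h resp N) (∣-union-below N h' resp' below'))
        where
        h' : Pt k l → Bool
        h' y = h y ∧ not (bl y ≡ᵇ N)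
        split : sumOn h ≡ sumOn (λ y → h y ∧ (bl y ≡ᵇ N)) + sumOn h'
        split = trans (ΣP-cong (λ y → onlyIf-split (h y) (bl y ≡ᵇ N) (s y)))
                      (ΣP-+ (λ y → onlyIf (h y ∧ (bl y ≡ᵇ N)) (s y)) (λ y → onlyIf (h' y) (s y)))
        resp' : RespectsBlocks h'
        resp' e = cong₂ (λ a b → a ∧ not b) (resp e) (cong (_≡ᵇ N) e)
        below' : ∀ y → h' y ≡ true → bl y < N
        below' y h'y with h y in hy | bl y ℕ.≟ N
        ... | true  | no ¬e = ℕ.≤∧≢⇒< (ℕ.≤-pred (below y hy)) ¬e
        ... | true  | yes e = contradiction (trans (sym (cong not (≡⇒≡ᵇ-true e))) h'y) λ ()
        ... | false | _     = contradiction h'y λ ()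

    ∣-sumOn-union-of-blocks : ∀ (h : Pt k l → Bool) → RespectsBlocks h → g ∣ sumOn h
    ∣-sumOn-union-of-blocks h resp =
      let N , bl<N = Pt-bounded bl in ∣-union-below N h resp (λ y _ → bl<N y)

-- σ under the operations of a category

inv-involutive : ∀ c → inv (inv c) ≡ c
inv-involutive white = refl
inv-involutive black = refl

onlyIf-sign-inv : ∀ b c → onlyIf b (sign (inv c)) ≡ - onlyIf b (sign c)
onlyIf-sign-inv false c     = refl
onlyIf-sign-inv true  white = refl
onlyIf-sign-inv true  black = refl

σ-single-block : ∀ {k l} (p : Partition k l) {b} → (∀ y → blk p y ≡ b) →
                 σ p b ≡ ΣP (sign ∘ normCol p)
σ-single-block p {b} one =
  ΣP-cong {f = contrib p b} λ y → cong (λ c → onlyIf c (sign (normCol p y))) (≡⇒≡ᵇ-true (one y))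

σ-id : ∀ {c} (p : Partition 1 1) → IsIdPartition c p → ∀ x → σ p (blk p x) ≡ 0ℤ
σ-id {c} p (lower , upper , same) x = begin
  σ p (blk p x)                                                            ≡⟨ σ-single-block p one-block ⟩
  (sign (col p (inj₁ zero)) + 0ℤ) + (sign (inv (col p (inj₂ zero))) + 0ℤ)
    ≡⟨ cong₂ (λ a b → (sign a + 0ℤ) + (sign (inv b) + 0ℤ)) lower upper ⟩
  (sign c + 0ℤ) + (sign (inv c) + 0ℤ)                                      ≡⟨ balanced c ⟩
  0ℤ                                                                       ∎
  where
  open ≡-Reasoning
  to-lower : ∀ y → blk p y ≡ blk p (inj₁ zero)
  to-lower (inj₁ zero) = refl
  to-lower (inj₂ zero) = sym same
  one-block : ∀ y → blk p y ≡ blk p x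
  one-block y = trans (to-lower y) (sym (to-lower x))
  balanced : ∀ c → (sign c + 0ℤ) + (sign (inv c) + 0ℤ) ≡ 0ℤ
  balanced white = refl
  balanced black = refl

σ-pair : ∀ {c} (p : Partition 2 0) → IsPairPartition c (inv c) p → ∀ x → σ p (blk p x) ≡ 0ℤ
σ-pair {c} p (left , right , same) x = begin
  σ p (blk p x)                                                             ≡⟨ σ-single-block p one-block ⟩
  (sign (col p (inj₁ zero)) + (sign (col p (inj₁ (suc zero))) + 0ℤ)) + 0ℤ
    ≡⟨ cong₂ (λ a b → (sign a + (sign b + 0ℤ)) + 0ℤ) left right ⟩
  (sign c + (sign (inv c) + 0ℤ)) + 0ℤ                                       ≡⟨ balanced c ⟩
  0ℤ                                                                        ∎
  where
  open ≡-Reasoning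
  to-left : ∀ y → blk p y ≡ blk p (inj₁ zero)
  to-left (inj₁ zero)       = refl
  to-left (inj₁ (suc zero)) = sym same
  one-block : ∀ y → blk p y ≡ blk p x
  one-block y = trans (to-left y) (sym (to-left x))
  balanced : ∀ c → (sign c + (sign (inv c) + 0ℤ)) + 0ℤ ≡ 0ℤ
  balanced white = refl
  balanced black = refl

module _ {k l k' l'} {p : Partition k l} {p' : Partition k' l'} {q} (t : IsTensor p p' q) where
  open IsTensor t

  private
    normCol-emb₁ : ∀ y → normCol q (emb₁ k' l' y) ≡ normCol p y
    normCol-emb₁ (inj₁ i) = col₁ (inj₁ i)
    normCol-emb₁ (inj₂ j) = cong inv (col₁ (inj₂ j))

    normCol-emb₂ : ∀ y → normCol q (emb₂ k l y) ≡ normCol p' y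
    normCol-emb₂ (inj₁ i) = col₂ (inj₁ i)
    normCol-emb₂ (inj₂ j) = cong inv (col₂ (inj₂ j))

  σ-tensorˡ : ∀ x → σ q (blk q (emb₁ k' l' x)) ≡ σ p (blk p x)
  σ-tensorˡ x = begin
    σ q b                                                  ≡⟨ ΣP-⊗ {k} {l} {k'} {l'} (contrib q b) ⟩
    ΣP (contrib q b ∘ emb₁ k' l') + ΣP (contrib q b ∘ emb₂ k l)
      ≡⟨ cong₂ _+_ (ΣP-cong same) (trans (ΣP-cong other) (ΣP-0 {k'} {l'})) ⟩
    σ p (blk p x) + 0ℤ                                     ≡⟨ ℤ.+-identityʳ _ ⟩
    σ p (blk p x)                                          ∎
    where
    open ≡-Reasoning
    b = blk q (emb₁ k' l' x)
    same : ∀ y → contrib q b (emb₁ k' l' y) ≡ contrib p (blk p x) y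
    same y = cong₂ (λ c n → onlyIf c (sign n)) (≡ᵇ-cong-⇔ (blk₁ y x)) (normCol-emb₁ y)
    other : ∀ z → contrib q b (emb₂ k l z) ≡ 0ℤ
    other z = cong (λ c → onlyIf c (sign (normCol q (emb₂ k l z))))
                   (≢⇒≡ᵇ-false λ e → blk₁₂ x z (sym e))

  σ-tensorʳ : ∀ x → σ q (blk q (emb₂ k l x)) ≡ σ p' (blk p' x)
  σ-tensorʳ x = begin
    σ q b                                                  ≡⟨ ΣP-⊗ {k} {l} {k'} {l'} (contrib q b) ⟩
    ΣP (contrib q b ∘ emb₁ k' l') + ΣP (contrib q b ∘ emb₂ k l)
      ≡⟨ cong₂ _+_ (trans (ΣP-cong other) (ΣP-0 {k} {l})) (ΣP-cong same) ⟩
    0ℤ + σ p' (blk p' x)                                   ≡⟨ ℤ.+-identityˡ _ ⟩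
    σ p' (blk p' x)                                        ∎
    where
    open ≡-Reasoning
    b = blk q (emb₂ k l x)
    same : ∀ y → contrib q b (emb₂ k l y) ≡ contrib p' (blk p' x) y
    same y = cong₂ (λ c n → onlyIf c (sign n)) (≡ᵇ-cong-⇔ (blk₂ y x)) (normCol-emb₂ y)
    other : ∀ z → contrib q b (emb₁ k' l' z) ≡ 0ℤ
    other z = cong (λ c → onlyIf c (sign (normCol q (emb₁ k' l' z))))
                   (≢⇒≡ᵇ-false (blk₁₂ z x))

σ-involution : ∀ {k l} {p : Partition k l} {q} → IsInvolution p q →
               ∀ x → σ q (blk q x) ≡ - σ p (blk p (swapPt x))
σ-involution {k} {l} {p} {q} i x = begin
  σ q (blk q x)                                 ≡⟨ ΣP-cong {f = contrib q (blk q x)} pointwise ⟩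
  ΣP (λ y → - contrib p b (swapPt y))           ≡⟨ ΣP-neg (contrib p b ∘ swapPt) ⟩
  - ΣP (contrib p b ∘ swapPt)                   ≡⟨ cong -_ (ΣP-swap (contrib p b)) ⟩
  - σ p b                                       ∎
  where
  open ≡-Reasoning
  open IsInvolution i
  b = blk p (swapPt x)
  normCol-swap : ∀ y → normCol q y ≡ inv (normCol p (swapPt y))
  normCol-swap (inj₁ j) = trans (colI (inj₁ j)) (sym (inv-involutive (col p (inj₂ j))))
  normCol-swap (inj₂ i) = cong inv (colI (inj₂ i))
  pointwise : ∀ y → contrib q (blk q x) y ≡ - contrib p b (swapPt y)
  pointwise y = begin
    onlyIf (blk q y ≡ᵇ blk q x) (sign (normCol q y))
      ≡⟨ cong₂ (λ c n → onlyIf c (sign n)) (≡ᵇ-cong-⇔ (blkI y x)) (normCol-swap y) ⟩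
    onlyIf (blk p (swapPt y) ≡ᵇ b) (sign (inv (normCol p (swapPt y))))
      ≡⟨ onlyIf-sign-inv (blk p (swapPt y) ≡ᵇ b) (normCol p (swapPt y)) ⟩
    - contrib p b (swapPt y)                                            ∎

module _ {k l m} {p : Partition k l} {p' : Partition l m} {q : Partition k m}
         (composable : Composable p p') (comp : IsComposition p p' q) (x₀ : Pt k m)
         (inClass? : ∀ a → Dec (Gen p p' (ιq x₀) a)) where
  open IsComposition comp

  private
    inClass : Pt3 k l m → Bool
    inClass a = does (inClass? a)

    inClass-resp : ∀ {a b} → Gen p p' a b → inClass a ≡ inClass b
    inClass-resp {a} {b} r =
      does-⇔ (mk⇔ (λ G → gtrans G r) (λ G → gtrans G (gsym r))) (inClass? a) (inClass? b)

    block-is-class : ∀ y → (blk q y ≡ᵇ blk q x₀) ≡ inClass (ιq y)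
    block-is-class y = does-⇔ (mk⇔ (gsym ∘ Equivalence.to (blkC y x₀))
                                   (Equivalence.from (blkC y x₀) ∘ gsym))
                              (blk q y ℕ.≟ blk q x₀) (inClass? (ιq y))

    F : Pt k l → ℤ
    F y = onlyIf (inClass (ιp y)) (sign (normCol p y))

    F' : Pt l m → ℤ
    F' y = onlyIf (inClass (ιp' y)) (sign (normCol p' y))

    middle-cancels : ∀ j → F (inj₂ j) + F' (inj₁ j) ≡ 0ℤ
    middle-cancels j = begin
      onlyIf c (sign (inv (col p (inj₂ j)))) + onlyIf c (sign d)
        ≡⟨ cong (λ e → onlyIf c (sign (inv e)) + onlyIf c (sign d)) (composable j) ⟩
      onlyIf c (sign (inv d)) + onlyIf c (sign d)
        ≡⟨ cong (_+ onlyIf c (sign d)) (onlyIf-sign-inv c d) ⟩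
      - onlyIf c (sign d) + onlyIf c (sign d)
        ≡⟨ ℤ.+-inverseˡ (onlyIf c (sign d)) ⟩
      0ℤ ∎
      where
      open ≡-Reasoning
      c = inClass (mid j)
      d = col p' (inj₁ j)

    σ-composition : σ q (blk q x₀) ≡ ΣP F + ΣP F'
    σ-composition = sym (ΣP-glue F F' (contrib q (blk q x₀)) lower upper middle-cancels)
      where
      lower : ∀ i → contrib q (blk q x₀) (inj₁ i) ≡ F (inj₁ i)
      lower i = cong₂ (λ c n → onlyIf c (sign n)) (block-is-class (inj₁ i)) (colL i)
      upper : ∀ u → contrib q (blk q x₀) (inj₂ u) ≡ F' (inj₂ u)
      upper u = cong₂ (λ c n → onlyIf c (sign (inv n))) (block-is-class (inj₂ u)) (colU u)

  ∣σ-composition : ∀ {g} → (∀ x → g ∣ σ p (blk p x)) → (∀ x → g ∣ σ p' (blk p' x)) →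
                   g ∣ σ q (blk q x₀)
  ∣σ-composition ∣σp ∣σp' =
    subst (_ ∣_) (sym σ-composition)
      (∣m∣n⇒∣m+n
        (∣-sumOn-union-of-blocks (blk p) (sign ∘ normCol p) ∣σp (inClass ∘ ιp) (inClass-resp ∘ viaP))
        (∣-sumOn-union-of-blocks (blk p') (sign ∘ normCol p') ∣σp' (inClass ∘ ιp') (inClass-resp ∘ viaP')))

-- Decidability under double negation

module _ where
  open RawMonad (¬¬-Monad {a = 0ℓ})

  ¬¬-decidable-Fin : ∀ n (P : Fin n → Set) → ¬ ¬ (∀ i → Dec (P i))
  ¬¬-decidable-Fin zero    P = pure λ ()
  ¬¬-decidable-Fin (suc n) P = do
    d₀ ← ¬¬-excluded-middle
    ds ← ¬¬-decidable-Fin n (P ∘ suc)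
    pure λ where
      zero    → d₀
      (suc i) → ds i

  ¬¬-decidable-Pt3 : ∀ {k l m} (P : Pt3 k l m → Set) → ¬ ¬ (∀ a → Dec (P a))
  ¬¬-decidable-Pt3 {k} {l} {m} P = do
    dlow ← ¬¬-decidable-Fin k (P ∘ low)
    dmid ← ¬¬-decidable-Fin l (P ∘ mid)
    dup  ← ¬¬-decidable-Fin m (P ∘ up)
    pure λ where
      (low i) → dlow i
      (mid j) → dmid j
      (up u)  → dup u

emb-cases : ∀ {k l k' l'} (x : Pt (k ℕ.+ k') (l ℕ.+ l')) →
            (∃ λ y → emb₁ k' l' y ≡ x) ⊎ (∃ λ z → emb₂ k l z ≡ x)
emb-cases {k} {l} (inj₁ i) with splitAt k i in eq
... | inj₁ j = inj₁ (inj₁ j , cong inj₁ (splitAt⁻¹-↑ˡ eq))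
... | inj₂ j = inj₂ (inj₁ j , cong inj₁ (splitAt⁻¹-↑ʳ eq))
emb-cases {k} {l} (inj₂ i) with splitAt l i in eq
... | inj₁ j = inj₁ (inj₂ j , cong inj₂ (splitAt⁻¹-↑ˡ eq))
... | inj₂ j = inj₂ (inj₂ j , cong inj₂ (splitAt⁻¹-↑ʳ eq))

module _ (g : ℕ) where

  -- Cg is phrased with unsigned divisibility, the lemmas above with signed divisibility.
  private
    fromCg : ∀ {k l} (p : Partition k l) → Cg g p → ∀ x → + g ∣ σ p (blk p x)
    fromCg p cp x = ∣ᵤ⇒∣ (cp x)

    toCg : ∀ {k l} (p : Partition k l) → (∀ x → + g ∣ σ p (blk p x)) → Cg g p
    toCg p ∣σ x = ∣⇒∣ᵤ {+ g} {σ p (blk p x)} (∣σ x)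

  Cg-id : ∀ {c} (p : Partition 1 1) → IsIdPartition c p → Cg g p
  Cg-id p idp = toCg p λ x → subst (_ ∣_) (sym (σ-id p idp x)) ∣0

  Cg-pair : ∀ {c} (p : Partition 2 0) → IsPairPartition c (inv c) p → Cg g p
  Cg-pair p pair = toCg p λ x → subst (_ ∣_) (sym (σ-pair p pair x)) ∣0

  Cg-tensor : ∀ {k l k' l'} {p : Partition k l} {p' : Partition k' l'} {q} →
              IsTensor p p' q → Cg g p → Cg g p' → Cg g q
  Cg-tensor {k} {l} {k'} {l'} {p} {p'} {q} t cp cp' = toCg q λ x → case x
    where
    case : ∀ x → + g ∣ σ q (blk q x)
    case x with emb-cases {k} {l} {k'} {l'} x
    ... | inj₁ (y , refl) = subst (_ ∣_) (sym (σ-tensorˡ t y)) (fromCg p cp y)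
    ... | inj₂ (z , refl) = subst (_ ∣_) (sym (σ-tensorʳ t z)) (fromCg p' cp' z)

  Cg-involution : ∀ {k l} {p : Partition k l} {q} → IsInvolution p q → Cg g p → Cg g q
  Cg-involution {p = p} {q} i cp = toCg q λ x →
    subst (_ ∣_) (sym (σ-involution i x)) (∣m⇒∣-m (fromCg p cp (swapPt x)))

  Cg-composition : ∀ {k l m} {p : Partition k l} {p' : Partition l m} {q} →
                   Composable p p' → IsComposition p p' q → Cg g p → Cg g p' → Cg g q
  Cg-composition {p = p} {p'} {q} composable comp cp cp' = toCg q λ x₀ →
    ∣-stable λ ∤ → ¬¬-decidable-Pt3 _ λ inClass? →
      ∤ (∣σ-composition composable comp x₀ inClass? (fromCg p cp) (fromCg p' cp'))

lemma7p1 : (g : ℕ) → IsCategory (Cg g)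
lemma7p1 g = record
  { hasEmpty    = λ p _ → λ { (inj₁ ()) ; (inj₂ ()) }
  ; hasIdW      = Cg-id g
  ; hasIdB      = Cg-id g
  ; hasPairBW   = Cg-pair g
  ; hasPairWB   = Cg-pair g
  ; tensor      = λ p p' q cp cp' t → Cg-tensor g t cp cp'
  ; involution  = λ p q cp i → Cg-involution g i cp
  ; composition = λ p p' q cp cp' composable comp → Cg-composition g composable comp cp cp'
  }
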